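{- Let $S$ be a finite subset of $\{1,2,\dots\}$, $w$ a permutation of $S$, and let $v=v_1v_2\cdots v_k\sim w$ be a concatenation of words such that (a) each $v_i$ is an increasing or decreasing sequence of consecutive integers, and (b) every $u\sim w$ has the form $u=v_1'\cdots v_k'$ with $v_i'\sim v_i$ for each $i$. Let $m_i$ be the length of $v_i$. Then the number of elements of the equivalence class of $w$ is $$\#\langle w\rangle=F_{m_1+1}F_{m_2+1}\cdots F_{m_k+1}.$$
   Context: For words whose entries are distinct positive integers, $u\sim v$ means $v$ can be obtained from $u$ by a sequence of interchanges of two adjacent entries differing by exactly $1$; $\langle w\rangle$ is the equivalence class of $w$. $F_m$ are the Fibonacci numbers, $F_1=F_2=1$, $F_m=F_{m-1}+F_{m-2}$. -}

module Defs where

open import Data.Nat using (ℕ; zero; suc; _+_; _*_; _<_)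
open import Data.List using (List; []; _∷_; _++_; map; upTo; reverse; concat; length)
open import Data.List.Relation.Unary.All using (All)
open import Data.List.Relation.Unary.Unique.Propositional using (Unique)
open import Data.List.Relation.Binary.Pointwise using (Pointwise)
open import Data.List.Membership.Propositional using (_∈_)
open import Data.Product using (Σ; ∃; ∃-syntax; _×_; _,_)
open import Data.Sum using (_⊎_)
open import Relation.Binary.PropositionalEquality using (_≡_)
open import Relation.Binary.Construct.Closure.ReflexiveTransitive using (Star)
open import Function.Bundles using (_⇔_)

Word : Set
Word = List ℕ

fib : ℕ → ℕ
fib zero = zero
fib (suc zero) = suc zero
fib (suc (suc n)) = fib (suc n) + fib n

DiffOne : ℕ → ℕ → Set
DiffOne a b = (suc a ≡ b) ⊎ (suc b ≡ a)

data Step : Word → Word → Set where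
  swap : (xs ys : Word) (a b : ℕ) → DiffOne a b →
         Step (xs ++ a ∷ b ∷ ys) (xs ++ b ∷ a ∷ ys)

_∼_ : Word → Word → Set
u ∼ v = Star Step u v

infix 4 _∼_

-- w has distinct positive entries (w is a permutation of a finite S ⊆ {1,2,...})
DistinctPositive : Word → Set
DistinctPositive w = Unique w × All (0 <_) w

incRun : ℕ → ℕ → Word
incRun a m = map (a +_) (upTo m)

ConsecutiveRun : Word → Set
ConsecutiveRun v = ∃[ a ] ∃[ m ] ((v ≡ incRun a m) ⊎ (v ≡ reverse (incRun a m)))

ClassSize : Word → ℕ → Set
ClassSize w N = ∃[ cls ] (Unique cls × (∀ u → (u ∈ cls) ⇔ (u ∼ w)) × length cls ≡ N)

-- Every word equivalent to a run a, a+1, …, a+m−1 is obtained from it by swapping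
-- some disjoint adjacent pairs, i.e. it is a tiling of length m by monominoes (x)
-- and dominoes (x+1, x); there are F (m+1) such tilings, and decreasing runs are
-- handled by reversal. Hypothesis (b) says that the class of w is the image of the
-- product of the classes of the runs under concatenation, which is injective since
-- equivalent words have equal lengths; so the class sizes multiply.
module Submission where

open import Defs
open import Data.Nat using (ℕ; zero; suc; _+_; _*_)
open import Data.Nat.Properties using (+-suc; +-identityʳ; suc-injective; 1+n≢n)
open import Data.Nat.ListAction using (product)
open import Data.List
  using (List; []; _∷_; _++_; map; concat; length; reverse; upTo; applyUpTo; cartesianProduct)
open import Data.List.Properties
  using ( length-++; length-map; length-upTo; length-reverse; map-upTo; map-∘; map-cong
        ; ++-assoc; reverse-++; reverse-involutive; reverse-injective
        ; ∷-injective; ∷-injectiveˡ; ∷-injectiveʳ)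
open import Data.List.Relation.Unary.All using (All; []; _∷_)
import Data.List.Relation.Unary.All as All
import Data.List.Relation.Unary.All.Properties as All
open import Data.List.Relation.Unary.AllPairs using ([]; _∷_)
open import Data.List.Relation.Unary.Any using (here; there)
open import Data.List.Relation.Unary.Unique.Propositional using (Unique)
import Data.List.Relation.Unary.Unique.Propositional.Properties as Unique
open import Data.List.Relation.Binary.Pointwise using (Pointwise; []; _∷_)
open import Data.List.Membership.Propositional using (_∈_)
open import Data.List.Membership.Propositional.Properties
  using ( ∈-map⁺; ∈-map⁻; ∈-++⁺ˡ; ∈-++⁺ʳ; ∈-++⁻
        ; ∈-cartesianProduct⁺; ∈-cartesianProduct⁻)
open import Data.Product using (∃-syntax; _×_; _,_; uncurry; map₁)
open import Data.Sum using (inj₁; inj₂)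
open import Data.Empty using (⊥; ⊥-elim)
open import Relation.Unary using (_∪_; _⟨×⟩_; ｛_｝)
open import Relation.Binary.PropositionalEquality
  using (_≡_; refl; sym; trans; cong; cong₂; subst; subst₂; module ≡-Reasoning)
open import Relation.Binary.Construct.Closure.ReflexiveTransitive using (ε; _◅_; _◅◅_; gmap)
import Relation.Binary.Construct.Closure.ReflexiveTransitive as Star
open import Function using (_∘_)
open import Function.Bundles using (_⇔_; mk⇔; Equivalence)
open import Function.Construct.Composition using (_⇔-∘_)
open import Function.Construct.Symmetry using (⇔-sym)

open Equivalence using (to; from)

DiffOne-sym : ∀ {a b} → DiffOne a b → DiffOne b a
DiffOne-sym (inj₁ p) = inj₂ p
DiffOne-sym (inj₂ p) = inj₁ p

Step-sym : ∀ {u v} → Step u v → Step v u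
Step-sym (swap xs ys a b d) = swap xs ys b a (DiffOne-sym d)

∼-sym : ∀ {u v} → u ∼ v → v ∼ u
∼-sym = Star.reverse Step-sym

∼-length : ∀ {u v} → u ∼ v → length u ≡ length v
∼-length ε = refl
∼-length (swap xs _ _ _ _ ◅ p) = trans (trans (length-++ xs) (sym (length-++ xs))) (∼-length p)

Step-++ʳ : ∀ c {u v} → Step u v → Step (u ++ c) (v ++ c)
Step-++ʳ c (swap xs ys a b d) =
  subst₂ Step (sym (++-assoc xs (a ∷ b ∷ ys) c)) (sym (++-assoc xs (b ∷ a ∷ ys) c))
    (swap xs (ys ++ c) a b d)

Step-++ˡ : ∀ c {u v} → Step u v → Step (c ++ u) (c ++ v)
Step-++ˡ c (swap xs ys a b d) =
  subst₂ Step (++-assoc c xs (a ∷ b ∷ ys)) (++-assoc c xs (b ∷ a ∷ ys))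
    (swap (c ++ xs) ys a b d)

∼-++ : ∀ {u v x y} → u ∼ v → x ∼ y → u ++ x ∼ v ++ y
∼-++ {v = v} {x} p q = gmap (_++ x) (Step-++ʳ x) p ◅◅ gmap (v ++_) (Step-++ˡ v) q

reverse-swap : ∀ xs (a b : ℕ) ys → reverse (xs ++ a ∷ b ∷ ys) ≡ reverse ys ++ b ∷ a ∷ reverse xs
reverse-swap xs a b ys = begin
  reverse (xs ++ a ∷ b ∷ ys)                ≡⟨ reverse-++ xs (a ∷ b ∷ ys) ⟩
  reverse ((a ∷ b ∷ []) ++ ys) ++ reverse xs ≡⟨ cong (_++ reverse xs) (reverse-++ (a ∷ b ∷ []) ys) ⟩
  (reverse ys ++ b ∷ a ∷ []) ++ reverse xs   ≡⟨ ++-assoc (reverse ys) (b ∷ a ∷ []) (reverse xs) ⟩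
  reverse ys ++ b ∷ a ∷ reverse xs           ∎
  where open ≡-Reasoning

Step-reverse : ∀ {u v} → Step u v → Step (reverse u) (reverse v)
Step-reverse (swap xs ys a b d) =
  subst₂ Step (sym (reverse-swap xs a b ys)) (sym (reverse-swap xs b a ys))
    (swap (reverse ys) (reverse xs) b a (DiffOne-sym d))

∼-reverse : ∀ {u v} → u ∼ v → reverse u ∼ reverse v
∼-reverse = gmap reverse Step-reverse

Counted : {A : Set} → (A → Set) → ℕ → Set
Counted P n = ∃[ cs ] (Unique cs × (∀ x → (x ∈ cs) ⇔ P x) × length cs ≡ n)

Counted-cong : {A : Set} {P Q : A → Set} {n : ℕ} →
               (∀ x → P x ⇔ Q x) → Counted P n → Counted Q n
Counted-cong P⇔Q (cs , cs! , ∈⇔P , ∣cs∣) = cs , cs! , (λ x → P⇔Q x ⇔-∘ ∈⇔P x) , ∣cs∣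

Counted-singleton : {A : Set} (x : A) → Counted ｛ x ｝ 1
Counted-singleton x =
  x ∷ [] , [] ∷ [] , (λ _ → mk⇔ (λ { (here p) → sym p }) (λ { refl → here refl })) , refl

Counted-∪ : {A : Set} {P Q : A → Set} {m n : ℕ} →
            Counted P m → Counted Q n → (∀ {x} → P x → Q x → ⊥) → Counted (P ∪ Q) (m + n)
Counted-∪ {P = P} {Q} (cs , cs! , ∈⇔P , ∣cs∣) (ds , ds! , ∈⇔Q , ∣ds∣) P#Q =
  cs ++ ds ,
  Unique.++⁺ cs! ds! (λ (x∈cs , x∈ds) → P#Q (to (∈⇔P _) x∈cs) (to (∈⇔Q _) x∈ds)) ,
  (λ x → mk⇔ (membership x) (λ { (inj₁ Px) → ∈-++⁺ˡ (from (∈⇔P x) Px)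
                               ; (inj₂ Qx) → ∈-++⁺ʳ cs (from (∈⇔Q x) Qx) })) ,
  trans (length-++ cs) (cong₂ _+_ ∣cs∣ ∣ds∣)
  where
  membership : ∀ x → x ∈ cs ++ ds → (P ∪ Q) x
  membership x x∈ with ∈-++⁻ cs x∈
  ... | inj₁ x∈cs = inj₁ (to (∈⇔P x) x∈cs)
  ... | inj₂ x∈ds = inj₂ (to (∈⇔Q x) x∈ds)

length-cartesianProduct : {A B : Set} (xs : List A) (ys : List B) →
                          length (cartesianProduct xs ys) ≡ length xs * length ys
length-cartesianProduct []       ys = refl
length-cartesianProduct (x ∷ xs) ys =
  trans (length-++ (map (x ,_) ys))
        (cong₂ _+_ (length-map (x ,_) ys) (length-cartesianProduct xs ys))

Counted-⟨×⟩ : {A B : Set} {P : A → Set} {Q : B → Set} {m n : ℕ} →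
              Counted P m → Counted Q n → Counted (P ⟨×⟩ Q) (m * n)
Counted-⟨×⟩ (cs , cs! , ∈⇔P , ∣cs∣) (ds , ds! , ∈⇔Q , ∣ds∣) =
  cartesianProduct cs ds ,
  Unique.cartesianProduct⁺ cs! ds! ,
  (λ (x , y) → mk⇔
    (λ xy∈ → let x∈cs , y∈ds = ∈-cartesianProduct⁻ cs ds xy∈
             in to (∈⇔P x) x∈cs , to (∈⇔Q y) y∈ds)
    (λ (Px , Qy) → ∈-cartesianProduct⁺ (from (∈⇔P x) Px) (from (∈⇔Q y) Qy))) ,
  trans (length-cartesianProduct cs ds) (cong₂ _*_ ∣cs∣ ∣ds∣)

Image : {A B : Set} → (A → B) → (A → Set) → B → Set
Image f P y = ∃[ x ] (P x × y ≡ f x)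

Unique-map⁺-on : {A B : Set} {f : A → B} {xs : List A} →
                 (∀ {x y} → x ∈ xs → y ∈ xs → f x ≡ f y → x ≡ y) →
                 Unique xs → Unique (map f xs)
Unique-map⁺-on inj []           = []
Unique-map⁺-on inj (x∉xs ∷ xs!) =
  All.map⁺ (All.tabulate λ y∈xs fx≡fy →
              All.lookup x∉xs y∈xs (inj (here refl) (there y∈xs) fx≡fy))
  ∷ Unique-map⁺-on (λ x∈ y∈ → inj (there x∈) (there y∈)) xs!

Counted-image : {A B : Set} {P : A → Set} {n : ℕ} (f : A → B) →
                (∀ {x y} → P x → P y → f x ≡ f y → x ≡ y) →
                Counted P n → Counted (Image f P) n
Counted-image f inj (cs , cs! , ∈⇔P , ∣cs∣) =
  map f cs ,
  Unique-map⁺-on (λ x∈ y∈ → inj (to (∈⇔P _) x∈) (to (∈⇔P _) y∈)) cs! ,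
  (λ y → mk⇔ (λ y∈ → let x , x∈cs , y≡fx = ∈-map⁻ f y∈
                     in x , to (∈⇔P x) x∈cs , y≡fx)
             (λ { (x , Px , refl) → ∈-map⁺ f (from (∈⇔P x) Px) })) ,
  trans (length-map f cs) ∣cs∣

incRun-suc : ∀ a m → incRun a (suc m) ≡ a ∷ incRun (suc a) m
incRun-suc a m = cong₂ _∷_ (+-identityʳ a) (begin
  map (a +_) (applyUpTo suc m)   ≡⟨ cong (map (a +_)) (sym (map-upTo suc m)) ⟩
  map (a +_) (map suc (upTo m))  ≡⟨ sym (map-∘ (upTo m)) ⟩
  map ((a +_) ∘ suc) (upTo m)    ≡⟨ map-cong (+-suc a) (upTo m) ⟩
  incRun (suc a) m               ∎)
  where open ≡-Reasoning

length-incRun : ∀ a m → length (incRun a m) ≡ m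
length-incRun a m = trans (length-map (a +_) (upTo m)) (length-upTo m)

data DominoTiling : ℕ → ℕ → Word → Set where
  nil    : ∀ {a} → DominoTiling a 0 []
  mono   : ∀ {a m t} → DominoTiling (suc a) m t → DominoTiling a (suc m) (a ∷ t)
  domino : ∀ {a m t} → DominoTiling (suc (suc a)) m t →
           DominoTiling a (suc (suc m)) (suc a ∷ a ∷ t)

swap-into-head : ∀ {a m y ys} → DiffOne a y →
                 DominoTiling (suc a) m (y ∷ ys) → DominoTiling a (suc m) (y ∷ a ∷ ys)
swap-into-head _         (mono t)   = domino t
swap-into-head (inj₁ ()) (domino t)
swap-into-head (inj₂ ()) (domino t)

DiffOne-head-out-of-reach : ∀ {a m y ys} → DiffOne a y → DominoTiling (suc (suc a)) m (y ∷ ys) → ⊥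
DiffOne-head-out-of-reach (inj₁ ()) (mono t)
DiffOne-head-out-of-reach (inj₂ ()) (mono t)
DiffOne-head-out-of-reach (inj₁ ()) (domino t)
DiffOne-head-out-of-reach (inj₂ ()) (domino t)

-- A swap either splits a domino into two monominoes or merges two monominoes into a
-- domino: any other pair of adjacent entries of a tiling differs by more than 1.
DominoTiling-swap : ∀ xs {a m} x y ys → DiffOne x y →
                    DominoTiling a m (xs ++ x ∷ y ∷ ys) → DominoTiling a m (xs ++ y ∷ x ∷ ys)
DominoTiling-swap []            x y ys d (mono t)   = swap-into-head d t
DominoTiling-swap []            x y ys d (domino t) = mono (mono t)
DominoTiling-swap (_ ∷ [])      x y ys d (mono t)   = mono (DominoTiling-swap [] x y ys d t)
DominoTiling-swap (_ ∷ [])      x y ys d (domino t) = ⊥-elim (DiffOne-head-out-of-reach d t)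
DominoTiling-swap (_ ∷ x₁ ∷ xs) x y ys d (mono t)   = mono (DominoTiling-swap (x₁ ∷ xs) x y ys d t)
DominoTiling-swap (_ ∷ _ ∷ xs)  x y ys d (domino t) = domino (DominoTiling-swap xs x y ys d t)

DominoTiling-∼ : ∀ {a m u v} → DominoTiling a m u → u ∼ v → DominoTiling a m v
DominoTiling-∼ t ε                         = t
DominoTiling-∼ t (swap xs ys x y d ◅ steps) = DominoTiling-∼ (DominoTiling-swap xs x y ys d t) steps

DominoTiling-incRun : ∀ a m → DominoTiling a m (incRun a m)
DominoTiling-incRun a zero    = nil
DominoTiling-incRun a (suc m) =
  subst (DominoTiling a (suc m)) (sym (incRun-suc a m)) (mono (DominoTiling-incRun (suc a) m))

DominoTiling⇒∼incRun : ∀ {a m u} → DominoTiling a m u → u ∼ incRun a m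
DominoTiling⇒∼incRun nil = ε
DominoTiling⇒∼incRun {a} {suc m} (mono {t = t} tiling) =
  subst (a ∷ t ∼_) (sym (incRun-suc a m)) (∼-++ {a ∷ []} ε (DominoTiling⇒∼incRun tiling))
DominoTiling⇒∼incRun {a} {suc (suc m)} (domino {t = t} tiling) =
  swap [] t (suc a) a (inj₂ refl) ◅
  subst (a ∷ suc a ∷ t ∼_) (sym (trans (incRun-suc a (suc m)) (cong (a ∷_) (incRun-suc (suc a) m))))
    (∼-++ {a ∷ suc a ∷ []} ε (DominoTiling⇒∼incRun tiling))

DominoTiling⇔∼incRun : ∀ a m u → DominoTiling a m u ⇔ u ∼ incRun a m
DominoTiling⇔∼incRun a m u =
  mk⇔ DominoTiling⇒∼incRun (λ u∼run → DominoTiling-∼ (DominoTiling-incRun a m) (∼-sym u∼run))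

DominoTiling-first-tile : ∀ a m u →
  DominoTiling a (suc (suc m)) u ⇔
  (Image (a ∷_) (DominoTiling (suc a) (suc m)) ∪
   Image (λ t → suc a ∷ a ∷ t) (DominoTiling (suc (suc a)) m)) u
DominoTiling-first-tile a m u = mk⇔
  (λ { (mono t) → inj₁ (_ , t , refl) ; (domino t) → inj₂ (_ , t , refl) })
  (λ { (inj₁ (_ , t , refl)) → mono t ; (inj₂ (_ , t , refl)) → domino t })

Counted-DominoTiling : ∀ a m → Counted (DominoTiling a m) (fib (suc m))
Counted-DominoTiling a zero =
  Counted-cong (λ _ → mk⇔ (λ { refl → nil }) (λ { nil → refl })) (Counted-singleton [])
Counted-DominoTiling a (suc zero) =
  Counted-cong (λ _ → mk⇔ (λ { refl → mono nil }) (λ { (mono nil) → refl }))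
    (Counted-singleton (a ∷ []))
Counted-DominoTiling a (suc (suc m)) =
  Counted-cong (λ u → ⇔-sym (DominoTiling-first-tile a m u))
    (Counted-∪ (Counted-image (a ∷_) (λ _ _ → ∷-injectiveʳ)
                              (Counted-DominoTiling (suc a) (suc m)))
               (Counted-image (λ t → suc a ∷ a ∷ t) (λ _ _ → ∷-injectiveʳ ∘ ∷-injectiveʳ)
                              (Counted-DominoTiling (suc (suc a)) m))
               first-tiles-differ)
  where
  first-tiles-differ : ∀ {u} → Image (a ∷_) (DominoTiling (suc a) (suc m)) u →
                       Image (λ t → suc a ∷ a ∷ t) (DominoTiling (suc (suc a)) m) u → ⊥
  first-tiles-differ (_ , _ , refl) (_ , _ , a∷t≡) = 1+n≢n (sym (∷-injectiveˡ a∷t≡))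

ClassSize-incRun : ∀ a m → ClassSize (incRun a m) (fib (suc m))
ClassSize-incRun a m = Counted-cong (DominoTiling⇔∼incRun a m) (Counted-DominoTiling a m)

∼reverse⇔Image : ∀ v u → u ∼ reverse v ⇔ Image reverse (_∼ v) u
∼reverse⇔Image v u = mk⇔
  (λ u∼ → reverse u ,
          subst (reverse u ∼_) (reverse-involutive v) (∼-reverse u∼) ,
          sym (reverse-involutive u))
  (λ { (x , x∼v , refl) → ∼-reverse x∼v })

ClassSize-reverse : ∀ {v n} → ClassSize v n → ClassSize (reverse v) n
ClassSize-reverse {v} c =
  Counted-cong (λ u → ⇔-sym (∼reverse⇔Image v u))
    (Counted-image reverse (λ _ _ → reverse-injective) c)

ClassSize-ConsecutiveRun : ∀ v → ConsecutiveRun v → ClassSize v (fib (suc (length v)))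
ClassSize-ConsecutiveRun _ (a , m , inj₁ refl)
  rewrite length-incRun a m = ClassSize-incRun a m
ClassSize-ConsecutiveRun _ (a , m , inj₂ refl)
  rewrite length-reverse (incRun a m) | length-incRun a m = ClassSize-reverse (ClassSize-incRun a m)

++-injective-sameLength : ∀ {xs xs′ ys ys′ : Word} →
                          length xs ≡ length xs′ → xs ++ ys ≡ xs′ ++ ys′ →
                          xs ≡ xs′ × ys ≡ ys′
++-injective-sameLength {[]}     {[]}     _ eq = refl , eq
++-injective-sameLength {x ∷ xs} {_ ∷ xs′} ∣xs∣ eq with ∷-injective eq
... | refl , eq′ = map₁ (cong (x ∷_)) (++-injective-sameLength (suc-injective ∣xs∣) eq′)

Piecewise∼ : List Word → Word → Set
Piecewise∼ vs u = ∃[ us ] (Pointwise _∼_ us vs × u ≡ concat us)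

Piecewise∼-∷ : ∀ v vs u →
               Piecewise∼ (v ∷ vs) u ⇔ Image (uncurry _++_) ((_∼ v) ⟨×⟩ Piecewise∼ vs) u
Piecewise∼-∷ v vs u = mk⇔
  (λ { (x ∷ us , x∼v ∷ us∼vs , refl) → (x , concat us) , (x∼v , us , us∼vs , refl) , refl })
  (λ { ((x , _) , (x∼v , us , us∼vs , refl) , refl) → x ∷ us , x∼v ∷ us∼vs , refl })

Counted-Piecewise∼ : ∀ vs → All ConsecutiveRun vs →
                     Counted (Piecewise∼ vs) (product (map (λ v → fib (suc (length v))) vs))
Counted-Piecewise∼ [] [] =
  Counted-cong (λ _ → mk⇔ (λ { refl → [] , [] , refl }) (λ { ([] , [] , refl) → refl }))
    (Counted-singleton [])
Counted-Piecewise∼ (v ∷ vs) (run ∷ runs) =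
  Counted-cong (λ u → ⇔-sym (Piecewise∼-∷ v vs u))
    (Counted-image (uncurry _++_) concat-injective
      (Counted-⟨×⟩ (ClassSize-ConsecutiveRun v run) (Counted-Piecewise∼ vs runs)))
  where
  concat-injective : ∀ {p q} → ((_∼ v) ⟨×⟩ Piecewise∼ vs) p → ((_∼ v) ⟨×⟩ Piecewise∼ vs) q →
                     uncurry _++_ p ≡ uncurry _++_ q → p ≡ q
  concat-injective (x∼v , _) (x′∼v , _) eq =
    let x≡x′ , y≡y′ = ++-injective-sameLength (trans (∼-length x∼v) (sym (∼-length x′∼v))) eq
    in cong₂ _,_ x≡x′ y≡y′

Pointwise∼⇒concat∼ : ∀ {us vs} → Pointwise _∼_ us vs → concat us ∼ concat vs
Pointwise∼⇒concat∼ []       = ε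
Pointwise∼⇒concat∼ (p ∷ pw) = ∼-++ p (Pointwise∼⇒concat∼ pw)

-- Distinctness of the entries is not needed: hypothesis (b) already pins down the class.
proposition2p8 : (w : Word) → DistinctPositive w →
    (vs : List Word) → concat vs ∼ w →
    All ConsecutiveRun vs →
    (∀ u → u ∼ w → ∃[ us ] (Pointwise _∼_ us vs × u ≡ concat us)) →
    ClassSize w (product (map (λ v → fib (suc (length v))) vs))
proposition2p8 w _ vs vs∼w runs factorise =
  Counted-cong (λ u → mk⇔ piecewise⇒∼ (factorise u)) (Counted-Piecewise∼ vs runs)
  where
  piecewise⇒∼ : ∀ {u} → Piecewise∼ vs u → u ∼ w
  piecewise⇒∼ (_ , us∼vs , refl) = Pointwise∼⇒concat∼ us∼vs ◅◅ vs∼w
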